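{- Let $L$ be an ABC-function on a graph $G=(V,E)$. Then for every profile $\pi$ with $|\pi|\ge 2$ and every vertex $x\in V$ such that $x\in L(\pi,x)$, we have $\bigcap_{y\in\pi}I(x,y)=\{x\}$.
   Context: Graphs are undirected, simple and connected; $d$ is the distance, $I(u,v)=\{w:d(u,w)+d(w,v)=d(u,v)\}$. A profile is a finite sequence of vertices (repetitions allowed); $|\pi|$ is its length; $V^*$ is the set of profiles, $\pi\rho$ concatenation and $(\pi,x)$ the profile $\pi$ with $x$ appended. A consensus function is a map $L:V^*\to 2^V\setminus\{\emptyset\}$. An ABC-function satisfies: (A) invariance under permutations of the profile; (B) $L(u,v)=I(u,v)$ for all $u,v$; (C) if $L(\pi)\cap L(\rho)\neq\emptyset$ then $L(\pi\rho)=L(\pi)\cap L(\rho)$. -}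

module Defs where

open import Level using (Level; 0ℓ)
open import Data.Nat using (ℕ; zero; suc; _+_; _≤_)
open import Data.Product using (Σ; ∃; _×_; _,_)
open import Data.List using (List; []; _∷_; _++_; [_]; length)
open import Data.List.Membership.Propositional using (_∈_)
open import Data.List.Relation.Binary.Permutation.Propositional using (_↭_)
open import Relation.Binary.PropositionalEquality using (_≡_)
open import Relation.Nullary using (¬_)
open import Function.Bundles using (_⇔_)

record Graph (V : Set) : Set₁ where
  field
    E         : V → V → Set
    E-sym     : ∀ {u v} → E u v → E v u
    E-irrefl  : ∀ {u} → ¬ E u u

  data Walk : V → V → ℕ → Set where
    here : ∀ {u} → Walk u u zero
    step : ∀ {u v w k} → E u v → Walk v w k → Walk u w (suc k)

  Dist : V → V → ℕ → Set
  Dist u v k = Walk u v k × (∀ m → Walk u v m → k ≤ m)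

  I : V → V → V → Set
  I u v w = ∃ λ a → ∃ λ b → Dist u w a × Dist w v b × Dist u v (a + b)

record ConnectedGraph (V : Set) : Set₁ where
  field
    graph     : Graph V
  open Graph graph public
  field
    connected : ∀ u v → ∃ λ k → Walk u v k

VSet : Set → Set₁
VSet V = V → Set

_≐_ : ∀ {V} → VSet V → VSet V → Set
A ≐ B = ∀ w → A w ⇔ B w

_∩_ : ∀ {V} → VSet V → VSet V → VSet V
(A ∩ B) w = A w × B w

Profile : Set → Set
Profile V = List V

NonEmpty : ∀ {V : Set} → Profile V → Set
NonEmpty π = ¬ (π ≡ [])

record ABCFunction {V : Set} (G : ConnectedGraph V) : Set₁ where
  open ConnectedGraph G
  field
    L        : Profile V → VSet V
    nonempty : ∀ π → NonEmpty π → ∃ λ x → L π x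
    axA      : ∀ {π ρ} → π ↭ ρ → L π ≐ L ρ
    axB      : ∀ u v → L (u ∷ v ∷ []) ≐ I u v
    axC      : ∀ π ρ → NonEmpty π → NonEmpty ρ →
               (∃ λ w → (L π ∩ L ρ) w) → L (π ++ ρ) ≐ (L π ∩ L ρ)

{-# OPTIONS --safe #-}
module Submission where

open import Defs
open import Data.Nat using (zero; suc; _+_; _≤_; z≤n; s≤s)
open import Data.Nat.Properties using (m+n≤o⇒m≤o; n≤0⇒n≡0)
open import Data.List using (List; []; _∷_; _++_; [_]; length; replicate)
open import Data.List.Properties using (++-assoc)
open import Data.List.Membership.Propositional using (_∈_)
open import Data.List.Relation.Unary.Any using (here; there)
open import Data.List.Relation.Binary.Permutation.Propositional
  using (_↭_; ↭-refl; ↭-prep; ↭-swap; ↭-trans; ↭-sym)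
open import Data.List.Relation.Binary.Permutation.Propositional.Properties using (shift)
open import Data.Product using (_,_; proj₁; proj₂)
open import Relation.Binary.PropositionalEquality using (_≡_; refl; sym; subst)
open import Function.Bundles using (_⇔_; mk⇔; Equivalence)

-- If w lies in I(x,y) for every y in π = y₁ … yₖ, then w lies in L of the profile
-- x y₁ x y₂ … x yₖ, by axiom C applied to the pairs (x,yᵢ), all of which contain x.
-- Permuting, that profile is (π, x) followed by k − 1 further copies of x. Since x is
-- in L(π, x) and L(x,…,x) = {x}, axiom C once more gives w ∈ L(x,…,x), i.e. w = x.

module WalkProperties {V : Set} (G : Graph V) where
  open Graph G

  Walk-zero⇒≡ : ∀ {u v} → Walk u v 0 → u ≡ v
  Walk-zero⇒≡ here = refl

  Dist-refl : ∀ {u} → Dist u u 0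
  Dist-refl = here , λ _ _ → z≤n

  I-self⇒≡ : ∀ {x w} → I x x w → x ≡ w
  I-self⇒≡ (a , _ , (x→w , _) , _ , (_ , shortest))
    with refl ← n≤0⇒n≡0 (m+n≤o⇒m≤o a (shortest 0 here)) = Walk-zero⇒≡ x→w

interleave : {V : Set} → V → List V → List V
interleave x []       = []
interleave x (y ∷ ys) = x ∷ y ∷ interleave x ys

interleave-↭ : {V : Set} (x : V) (ys : List V) →
               interleave x ys ↭ ys ++ replicate (length ys) x
interleave-↭ x []       = ↭-refl
interleave-↭ x (y ∷ ys) =
  ↭-trans (↭-swap x y (interleave-↭ x ys))
          (↭-prep y (↭-sym (shift x ys (replicate (length ys) x))))

module ABCProperties {V : Set} {G : ConnectedGraph V} (F : ABCFunction G) where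
  open ConnectedGraph G
  open WalkProperties graph
  open ABCFunction F
  open Equivalence

  -- Connectivity alone does not yield a shortest walk constructively; the point of
  -- I(x,y) provided by the nonemptiness of L(x,y) carries the distance d(x,y).
  I-left : ∀ x y → I x y x
  I-left x y with nonempty (x ∷ y ∷ []) (λ ())
  ... | v , v∈L with to (axB x y v) v∈L
  ... | a , b , _ , _ , x→y = 0 , a + b , Dist-refl , x→y , x→y

  L-singleton : ∀ x w → L [ x ] w ⇔ w ≡ x
  L-singleton x w = mk⇔ (∈⇒≡ w) (λ { refl → subst (L [ x ]) (∈⇒≡ v v∈L) v∈L })
    where
    v = proj₁ (nonempty [ x ] (λ ()))
    v∈L = proj₂ (nonempty [ x ] (λ ()))
    ∈⇒≡ : ∀ u → L [ x ] u → u ≡ x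
    ∈⇒≡ u u∈L =
      sym (I-self⇒≡ (to (axB x x u)
        (from (axC [ x ] [ x ] (λ ()) (λ ()) (v , v∈L , v∈L) u) (u∈L , u∈L))))

  L-replicate : ∀ n x w → L (replicate (suc n) x) w ⇔ w ≡ x
  L-replicate zero x w = L-singleton x w
  L-replicate (suc n) x w = mk⇔
    (λ w∈L → to (L-singleton x w) (proj₁ (to (split w) w∈L)))
    (λ { refl → from (split x) (from (L-singleton x x) refl , from (L-replicate n x x) refl) })
    where
    split = axC [ x ] (replicate (suc n) x) (λ ()) (λ ())
                (x , from (L-singleton x x) refl , from (L-replicate n x x) refl)

  L-interleave : ∀ {x w} y ys → (∀ u → u ∈ y ∷ ys → I x u w) →
                 L (interleave x (y ∷ ys)) w
  L-interleave {x} {w} y [] w∈I = from (axB x y w) (w∈I y (here refl))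
  L-interleave {x} {w} y (z ∷ zs) w∈I =
    from (axC (x ∷ y ∷ []) (interleave x (z ∷ zs)) (λ ()) (λ ())
              (x , from (axB x y x) (I-left x y) , L-interleave z zs (λ u _ → I-left x u)) w)
         (from (axB x y w) (w∈I y (here refl)) , L-interleave z zs (λ u u∈ → w∈I u (there u∈)))

  ⋂I⊆self : ∀ {x w} y z zs → L ((y ∷ z ∷ zs) ++ [ x ]) x →
            (∀ u → u ∈ y ∷ z ∷ zs → I x u w) → w ≡ x
  ⋂I⊆self {x} {w} y z zs x∈L w∈I = to (L-replicate (length zs) x w) (proj₂ (to (split w) w∈split))
    where
    π = y ∷ z ∷ zs
    xs = replicate (suc (length zs)) x
    split = axC (π ++ [ x ]) xs (λ ()) (λ ()) (x , x∈L , from (L-replicate (length zs) x x) refl)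
    w∈split : L ((π ++ [ x ]) ++ xs) w
    w∈split = subst (λ ρ → L ρ w) (sym (++-assoc π [ x ] xs))
                (to (axA (interleave-↭ x π) w) (L-interleave y (z ∷ zs) w∈I))

lemma3 : {V : Set} (G : ConnectedGraph V) (F : ABCFunction G) →
    (π : List V) → 2 ≤ length π → (x : V) →
    ABCFunction.L F (π ++ [ x ]) x →
    ∀ w → (∀ y → y ∈ π → ConnectedGraph.I G x y w) ⇔ (w ≡ x)
lemma3 G F (y ∷ z ∷ zs) (s≤s (s≤s _)) x x∈L w =
  mk⇔ (⋂I⊆self y z zs x∈L) (λ { refl u _ → I-left x u })
  where open ABCProperties F
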